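{- Let $R$ be a rack on $[n]$, let $C_1,\dots,C_c$ be the vertex sets of the components of $G_{T(R)}$, and let $V=\{v_1,\dots,v_c\}$ with $v_k\in C_k$ for each $k$. Then $R$ is determined by $\mathcal{I}(R)$ together with the maps $(f_v|_{Z_v})_{v\in V}$; that is, any rack $R'$ on $[n]$ with $\mathcal{I}(R')=\mathcal{I}(R)$ whose maps $f'_v$ satisfy $f'_v|_{Z_v}=f_v|_{Z_v}$ for all $v\in V$ equals $R$.
   Context: Maps are written on the right; a rack on $[n]$ corresponds to maps $(f_y)_{y\in[n]}$, $(x)f_y=x\triangleright y$, each a permutation of $[n]$, with $f_{(y)f_z}=f_z^{ -1}f_yf_z$. For $S\subseteq[n]$, $G_S$ is the directed loopless multigraph on $[n]$ with an edge of colour $y$ from $x$ to $z$ iff $y\in S$, $x\neq z$, $(x)f_y=z$; components are those of the underlying undirected multigraph, $\mathrm{cp}(G)$ their number. $\Gamma_T^+(v)=\{(v)f_j: j\in T,\ (v)f_j\neq v\}$, $\Gamma_T^+(V)=\bigcup_{v\in V}\Gamma_T^+(v)$, $d_T^+=|\Gamma_T^+|$, subscript $R$ meaning $T=[n]$. $\Delta=(\log_2 n)^3$, $L=\lfloor(\log_2 n)^2\rfloor$, $S_{\leqslant\Delta}(R)=\{v: d_R^+(v)\leqslant\Delta\}$, $S_{>\Delta}(R)=[n]\setminus S_{\leqslant\Delta}(R)$. $T(R)$: if $S_{\leqslant\Delta}(R)=\emptyset$ then $T(R)=\emptyset$; otherwise order $S_{\leqslant\Delta}(R)$ as $u_1,u_2,\dots$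 where each $u_{k+1}$ minimises $\mathrm{cp}(G_{\{u_1,\dots,u_k,v\}})$ over remaining $v\in S_{\leqslant\Delta}(R)$ (ties broken by a fixed rule), and $T(R)=\{u_1,\dots,u_L\}$ if $|S_{\leqslant\Delta}(R)|\geqslant L$, else $T(R)=S_{\leqslant\Delta}(R)$. $T^+(R)=T(R)\cup\Gamma_R^+(T(R))$. For a multigraph $G$ and multiset $E$ of vertex pairs, $M(G,E)$ is the set of vertex sets $C$ of components of $G$ such that some pair in $E$ joins a vertex of $C$ to a vertex outside $C$. $\overrightarrow{E}_j$ is the edge set of $G_{\{j\}}$; $M_j=M(G_{T(R)},\overrightarrow{E}_j)$, $Y_j=\bigcup_{C\in M_j}C$, $Z_j=[n]\setminus Y_j$ (defined for all $j\in[n]$). $\mathbf{M}=(M_j)_{j\in S_{\leqslant\Delta}(R)\setminus T(R)}$ (increasing order of $j$), $Y=\bigcup_{j\in S_{\leqslant\Delta}(R)\setminus T(R)}Y_j\times\{j\}$, and $\mathcal{I}(R)=\bigl(S_{\leqslant\Delta}(R),\ \triangleright|_{[n]\times S_{>\Delta}(R)},\ T(R),\ \triangleright|_{T(R)\times[n]},\ \triangleright|_{[n]\times T^+(R)},\ \mathbf{M},\ \triangleright|_Y\bigr)$. -}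

module Defs where

open import Data.Bool using (Bool; true; false; not; _∧_; _∨_; if_then_else_)
open import Data.Nat using (ℕ; zero; suc; _+_; _*_; _^_; _≤_; _<_; _≤ᵇ_; _<ᵇ_; _⊓_)
open import Data.Nat.Properties using () renaming (_≟_ to _≟ℕ_)
open import Data.Fin using (Fin; toℕ; _≟_)
open import Data.List using (List; []; _∷_; _++_; foldr; allFin)
open import Data.Bool.ListAction using (any)
open import Data.Product using (Σ; Σ-syntax; _×_; _,_)
open import Data.Sum using (_⊎_)
open import Relation.Nullary using (¬_; does)
open import Relation.Binary.PropositionalEquality using (_≡_; _≢_)
open import Function.Bundles using (_⇔_)

-- For n ≥ 1 and naturals d, k ≥ 1:
--   d ≤ (log₂ n)^k  ⇔  ∀ p q, q > 0, p^k < d·q^k  →  2^p ≤ n^q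
-- (every non-negative rational p/q below d^(1/k) is ≤ log₂ n).

LogPowGe : (n k d : ℕ) → Set
LogPowGe n k d = ∀ p q → 0 < q → p ^ k < d * q ^ k → 2 ^ p ≤ n ^ q

IsFloorLogPow : (n k m : ℕ) → Set
IsFloorLogPow n k m = LogPowGe n k m × ¬ LogPowGe n k (suc m)

-- Racks on [n] = Fin n.  x ▷ y = (x) f_y.  Each f_y is a permutation
-- (with inverse inv y), and f_{(y) f_z} = f_z⁻¹ f_y f_z (maps on the right).

record Rack (n : ℕ) : Set where
  field
    _▷_   : Fin n → Fin n → Fin n
    inv   : Fin n → Fin n → Fin n
    inv-l : ∀ y x → inv y (x ▷ y) ≡ x
    inv-r : ∀ y x → (inv y x) ▷ y ≡ x
    conj  : ∀ y z w → w ▷ (y ▷ z) ≡ ((inv z w) ▷ y) ▷ z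

_==_ : ∀ {n} → Fin n → Fin n → Bool
x == y = does (x ≟ y)

_==ℕ_ : ℕ → ℕ → Bool
a ==ℕ b = does (a ≟ℕ b)

anyF : ∀ {n} → (Fin n → Bool) → Bool
anyF {n} p = any p (allFin n)

countF : ∀ {n} → (Fin n → Bool) → ℕ
countF {n} p = foldr (λ x acc → if p x then suc acc else acc) 0 (allFin n)

elem : ∀ {n} → Fin n → List (Fin n) → Bool
elem x us = any (λ u → u == x) us

-- a "fixed tie-breaking rule": given the sequence chosen so far and the
-- set of tied candidates, return one of them.
TieBreak : ℕ → Set
TieBreak n = List (Fin n) → (Fin n → Bool) → Fin n

ValidTie : ∀ {n} → TieBreak n → Set
ValidTie {n} tb = ∀ us (A : Fin n → Bool) v → A v ≡ true → A (tb us A) ≡ true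

module RackDefs {n : ℕ} (R : Rack n) where
  open Rack R

  -- underlying undirected adjacency of G_A (A a set of colours)
  adj : (Fin n → Bool) → Fin n → Fin n → Bool
  adj A x z = not (x == z) ∧ anyF (λ y → A y ∧ ((x ▷ y) == z ∨ (z ▷ y) == x))

  reach : (Fin n → Bool) → ℕ → Fin n → Fin n → Bool
  reach A zero    x z = x == z
  reach A (suc k) x z = reach A k x z ∨ anyF (λ w → reach A k x w ∧ adj A w z)

  -- same component of G_A (paths of length ≤ n suffice)
  conn : (Fin n → Bool) → Fin n → Fin n → Bool
  conn A = reach A n

  -- cp(G_A): number of components = number of vertices that are the
  -- least (in the order of Fin n) vertex of their component
  cp : (Fin n → Bool) → ℕ
  cp A = countF (λ v → not (anyF (λ u → (toℕ u <ᵇ toℕ v) ∧ conn A u v)))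

  outdeg : Fin n → ℕ
  outdeg v = countF (λ w → not (w == v) ∧ anyF (λ j → (v ▷ j) == w))

  module Params (D L : ℕ) (tb : TieBreak n) where
    -- D = ⌊Δ⌋ ; for natural d, d ≤ Δ ⇔ d ≤ ⌊Δ⌋
    Slow : Fin n → Bool
    Slow v = outdeg v ≤ᵇ D

    greedy : ℕ → List (Fin n) → List (Fin n)
    greedy zero    us = us
    greedy (suc k) us =
      if anyF cand then greedy k (us ++ (tb us tied ∷ [])) else us
      where
        cand : Fin n → Bool
        cand v = Slow v ∧ not (elem v us)
        val : Fin n → ℕ
        val v = cp (λ y → elem y us ∨ (y == v))
        m : ℕ
        m = foldr (λ v acc → if cand v then val v ⊓ acc else acc) (suc n) (allFin n)
        tied : Fin n → Bool
        tied v = cand v ∧ (val v ==ℕ m)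

    T : Fin n → Bool
    T v = elem v (greedy L [])

    Tplus : Fin n → Bool
    Tplus w = T w ∨ anyF (λ v → T v ∧ anyF (λ j → ((v ▷ j) == w) ∧ not ((v ▷ j) == v)))

    connT : Fin n → Fin n → Bool
    connT = conn T

    InY : Fin n → Fin n → Bool
    InY j w = anyF (λ x → not (x == (x ▷ j)) ∧ not (connT x (x ▷ j))
                          ∧ (connT w x ∨ connT w (x ▷ j)))

    Z : Fin n → Fin n → Bool
    Z j w = not (InY j w)

    InM : Fin n → (Fin n → Bool) → Set
    InM j C = Σ[ x ∈ Fin n ] ((∀ w → C w ≡ connT x w) ×
              Σ[ e ∈ Fin n ] ((e ▷ j) ≢ e ×
                ((C e ≡ true × C (e ▷ j) ≡ false) ⊎ (C e ≡ false × C (e ▷ j) ≡ true))))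

    -- index set S_{≤Δ}(R) ∖ T(R) of the tuple 𝐌
    Jdx : Fin n → Bool
    Jdx j = Slow j ∧ not (T j)

    YY : Fin n → Fin n → Bool
    YY y j = Jdx j ∧ InY j y

    IsTransversal : (Fin n → Set) → Set
    IsTransversal V = (∀ x → Σ[ v ∈ Fin n ] (V v × connT x v ≡ true))
                    × (∀ v w → V v → V w → connT v w ≡ true → v ≡ w)

RestrEq : ∀ {n} (R R' : Rack n) (Dm Dm' : Fin n → Fin n → Bool) → Set
RestrEq {n} R R' Dm Dm' =
  (∀ x y → Dm x y ≡ Dm' x y) × (∀ x y → Dm x y ≡ true → Rack._▷_ R x y ≡ Rack._▷_ R' x y)

SameI : ∀ {n} (D L : ℕ) (tb : TieBreak n) (R R' : Rack n) → Set
SameI {n} D L tb R R' =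
    (∀ v → P.Slow v ≡ P'.Slow v)
  × RestrEq R R' (λ x y → not (P.Slow y)) (λ x y → not (P'.Slow y))
  × (∀ v → P.T v ≡ P'.T v)
  × RestrEq R R' (λ x y → P.T x) (λ x y → P'.T x)
  × RestrEq R R' (λ x y → P.Tplus y) (λ x y → P'.Tplus y)
  × ((∀ j → P.Jdx j ≡ P'.Jdx j)
     × (∀ j → P.Jdx j ≡ true → ∀ (C : Fin n → Bool) → P.InM j C ⇔ P'.InM j C))
  × RestrEq R R' P.YY P'.YY
  where
    module P  = RackDefs.Params R  D L tb
    module P' = RackDefs.Params R' D L tb

RackEq : ∀ {n} → Rack n → Rack n → Set
RackEq R R' = ∀ x y → Rack._▷_ R x y ≡ Rack._▷_ R' x y

module Submission where

-- Write "f_j agrees" when f_j and f'_j coincide on Z_j.  Every value x ▷ y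
-- is covered by 𝓘(R) unless y ∈ S_{≤Δ} ∖ T and x ∈ Z_y, so it suffices to
-- show that every f_j agrees.  The argument rests on three facts:
--  * connectivity in G_A (defined via walks of length ≤ n) is an
--    equivalence relation; transitivity needs the observation that the
--    sets reachable in k steps stabilise by k = n (a counting argument);
--  * Y_j is a union of components of G_{T(R)}, and for t ∈ T(R) we have
--    Y_{j ▷ t} = Y_j, because f_t preserves every component and maps the
--    edges of colour j onto those of colour j ▷ t (self-distributivity);
--  * hence for t ∈ T(R), where f_t = f'_t is part of 𝓘(R), f_j agrees iff
--    f_{j ▷ t} agrees, i.e. agreement is constant on components of G_{T(R)}.
-- Since V meets every component, every f_j agrees.

open import Defs
open import Data.Nat using (ℕ)
open import Data.Fin using (Fin)
open import Data.Bool using (true)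
open import Relation.Binary.PropositionalEquality using (_≡_)

open import Data.Bool using (Bool; false; not; _∧_; _∨_; if_then_else_)
open import Data.Bool.Properties using (∧-conicalˡ; ∧-conicalʳ; ∨-comm; not-injective; not-¬; ¬-not)
open import Data.Bool.ListAction using (any)
open import Data.Nat using (zero; suc; _+_; _≤_; _<_; _≤?_; z≤n; s≤s; _∸_)
open import Data.Nat.Properties
  using (≤-trans; ≤-reflexive; <-≤-trans; ≤-<-trans; m≤n⇒m≤1+n; m<n⇒m<1+n; n<1+n; ≰⇒>;
         +-suc; +-identityʳ; m∸n+n≡m; m≤m+n; <-irrefl)
open import Data.Fin using (_≟_)
open import Data.List using (List; []; _∷_; foldr; allFin; length)
open import Data.List.Properties using (length-tabulate)
open import Data.List.Membership.Propositional using (_∈_)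
open import Data.List.Membership.Propositional.Properties using (∈-allFin)
open import Data.List.Relation.Unary.Any using (here; there)
open import Data.Product using (Σ; Σ-syntax; _×_; _,_)
open import Data.Sum using (_⊎_; inj₁; inj₂)
open import Function.Bundles using (mk⇔)
open import Relation.Nullary using (yes; no; contradiction)
open import Relation.Nullary.Decidable using (dec-true; dec-false; does-⇔)
open import Relation.Binary.PropositionalEquality using (refl; sym; trans; cong; cong₂; subst; module ≡-Reasoning)

∨-introˡ : ∀ {a} b → a ≡ true → a ∨ b ≡ true
∨-introˡ b refl = refl

∨-introʳ : ∀ a {b} → b ≡ true → a ∨ b ≡ true
∨-introʳ true  _ = refl
∨-introʳ false h = h

∨-elim : ∀ a {b} → a ∨ b ≡ true → a ≡ true ⊎ b ≡ true
∨-elim true  _ = inj₁ refl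
∨-elim false h = inj₂ h

∨-map : ∀ {a b c d} → (a ≡ true → c ≡ true) → (b ≡ true → d ≡ true) → a ∨ b ≡ true → c ∨ d ≡ true
∨-map {a} {d = d} f g h with ∨-elim a h
... | inj₁ ha = ∨-introˡ d (f ha)
... | inj₂ hb = ∨-introʳ _ (g hb)

∧-intro : ∀ {a b} → a ≡ true → b ≡ true → a ∧ b ≡ true
∧-intro refl h = h

bool-ext : ∀ {a b} → (a ≡ true → b ≡ true) → (b ≡ true → a ≡ true) → a ≡ b
bool-ext {false} {false} _ _ = refl
bool-ext {false} {true}  _ g = g refl
bool-ext {true}  {_}     f _ = sym (f refl)

==-sound : ∀ {n} {x y : Fin n} → (x == y) ≡ true → x ≡ y
==-sound {x = x} {y} h with x ≟ y
... | yes x≡y = x≡y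
==-sound () | no _

==-complete : ∀ {n} {x y : Fin n} → x ≡ y → (x == y) ≡ true
==-complete {x = x} {y} = dec-true (x ≟ y)

==-refl : ∀ {n} (x : Fin n) → (x == x) ≡ true
==-refl x = ==-complete {x = x} refl

==-sym : ∀ {n} (x y : Fin n) → (x == y) ≡ (y == x)
==-sym x y = does-⇔ (mk⇔ sym sym) (x ≟ y) (y ≟ x)

any-intro : ∀ {A : Set} (p : A → Bool) {xs} x → x ∈ xs → p x ≡ true → any p xs ≡ true
any-intro p x (here refl) px = ∨-introˡ _ px
any-intro p x (there {x = y} x∈xs) px = ∨-introʳ (p y) (any-intro p x x∈xs px)

any-elim : ∀ {A : Set} (p : A → Bool) xs → any p xs ≡ true → Σ A λ x → p x ≡ true
any-elim p (y ∷ ys) h with ∨-elim (p y) h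
... | inj₁ py = y , py
... | inj₂ h' = any-elim p ys h'

any-cong : ∀ {A : Set} {p q : A → Bool} → (∀ x → p x ≡ q x) → ∀ xs → any p xs ≡ any q xs
any-cong p≡q []       = refl
any-cong p≡q (y ∷ ys) = cong₂ _∨_ (p≡q y) (any-cong p≡q ys)

anyF-intro : ∀ {n} (p : Fin n → Bool) x → p x ≡ true → anyF p ≡ true
anyF-intro p x = any-intro p x (∈-allFin x)

anyF-elim : ∀ {n} (p : Fin n → Bool) → anyF p ≡ true → Σ (Fin n) λ x → p x ≡ true
anyF-elim {n} p = any-elim p (allFin n)

anyF-cong : ∀ {n} {p q : Fin n → Bool} → (∀ x → p x ≡ q x) → anyF p ≡ anyF q
anyF-cong {n} p≡q = any-cong p≡q (allFin n)

count : ∀ {A : Set} → (A → Bool) → List A → ℕ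
count p = foldr (λ x acc → if p x then suc acc else acc) 0

count-≤-length : ∀ {A : Set} (p : A → Bool) xs → count p xs ≤ length xs
count-≤-length p []       = z≤n
count-≤-length p (y ∷ ys) with p y
... | true  = s≤s (count-≤-length p ys)
... | false = m≤n⇒m≤1+n (count-≤-length p ys)

countF-≤ : ∀ {n} (p : Fin n → Bool) → countF p ≤ n
countF-≤ {n} p = ≤-trans (count-≤-length p (allFin n)) (≤-reflexive (length-tabulate {n = n} (λ i → i)))

module _ {A : Set} (p q : A → Bool) (p⊆q : ∀ x → p x ≡ true → q x ≡ true) where

  count-mono : ∀ xs → count p xs ≤ count q xs
  count-mono []       = z≤n
  count-mono (y ∷ ys) with p y in py | q y in qy
  ... | true  | true  = s≤s (count-mono ys)
  ... | true  | false = contradiction (trans (sym (p⊆q y py)) qy) λ ()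
  ... | false | true  = m≤n⇒m≤1+n (count-mono ys)
  ... | false | false = count-mono ys

  count-strict : ∀ xs z → z ∈ xs → p z ≡ false → q z ≡ true → count p xs < count q xs
  count-strict (y ∷ ys) z z∈ pz qz with p y in py | q y in qy
  ... | true  | false = contradiction (trans (sym (p⊆q y py)) qy) λ ()
  count-strict (y ∷ ys) .y (here refl) pz qz | true  | true = contradiction (trans (sym py) pz) λ ()
  count-strict (y ∷ ys) z  (there z∈) pz qz  | true  | true = s≤s (count-strict ys z z∈ pz qz)
  count-strict (y ∷ ys) .y (here refl) pz qz | false | true = s≤s (count-mono ys)
  count-strict (y ∷ ys) z  (there z∈) pz qz  | false | true = m<n⇒m<1+n (count-strict ys z z∈ pz qz)
  count-strict (y ∷ ys) .y (here refl) pz qz | false | false = contradiction (trans (sym qy) qz) λ ()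
  count-strict (y ∷ ys) z  (there z∈) pz qz  | false | false = count-strict ys z z∈ pz qz

countF-squeeze : ∀ {n} (p q : Fin n → Bool) → (∀ x → p x ≡ true → q x ≡ true) →
                 countF q ≤ countF p → ∀ z → q z ≡ true → p z ≡ true
countF-squeeze {n} p q p⊆q q≤p z qz with p z in pz
... | true  = refl
... | false = contradiction (<-≤-trans (count-strict p q p⊆q (allFin n) z (∈-allFin z) pz qz) q≤p) (<-irrefl refl)

module RackLaws {n : ℕ} (R : Rack n) where
  open Rack R

  ▷-cancel : ∀ t {a b} → a ▷ t ≡ b ▷ t → a ≡ b
  ▷-cancel t {a} {b} eq = trans (sym (inv-l t a)) (trans (cong (inv t) eq) (inv-l t b))

  self-distrib : ∀ x w t → (x ▷ t) ▷ (w ▷ t) ≡ (x ▷ w) ▷ t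
  self-distrib x w t = trans (conj w t (x ▷ t)) (cong (λ u → (u ▷ w) ▷ t) (inv-l t x))

module Connectivity {n : ℕ} (R : Rack n) (A : Fin n → Bool) where
  open Rack R
  open RackDefs R

  reach-suc : ∀ k {x z} → reach A k x z ≡ true → reach A (suc k) x z ≡ true
  reach-suc k = ∨-introˡ _

  reach-step : ∀ k {x w z} → reach A k x w ≡ true → adj A w z ≡ true → reach A (suc k) x z ≡ true
  reach-step k {x} {w} {z} xw wz =
    ∨-introʳ (reach A k x z) (anyF-intro (λ u → reach A k x u ∧ adj A u z) w (∧-intro xw wz))

  reach-mono : ∀ {k m x z} → k ≤ m → reach A k x z ≡ true → reach A m x z ≡ true
  reach-mono {k} {m} {x} {z} k≤m h =
    subst (λ j → reach A j x z ≡ true) (m∸n+n≡m k≤m) (go (m ∸ k))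
    where
      go : ∀ d → reach A (d + k) x z ≡ true
      go zero    = h
      go (suc d) = reach-suc (d + k) (go d)

  reach-trans : ∀ k m {x w z} → reach A k x w ≡ true → reach A m w z ≡ true → reach A (k + m) x z ≡ true
  reach-trans k zero {x} {w} xw wz rewrite +-identityʳ k =
    subst (λ v → reach A k x v ≡ true) (==-sound wz) xw
  reach-trans k (suc m) {x} {w} {z} xw wz
    rewrite +-suc k m with ∨-elim (reach A m w z) wz
  ... | inj₁ wz' = reach-suc (k + m) (reach-trans k m xw wz')
  ... | inj₂ h with anyF-elim (λ v → reach A m w v ∧ adj A v z) h
  ...   | v , wv∧vz = reach-step (k + m) (reach-trans k m xw (∧-conicalˡ _ _ wv∧vz)) (∧-conicalʳ (reach A m w v) _ wv∧vz)

  adj-sym : ∀ x z → adj A x z ≡ adj A z x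
  adj-sym x z = cong₂ _∧_ (cong not (==-sym x z)) (anyF-cong λ y → cong (A y ∧_) (∨-comm ((x ▷ y) == z) ((z ▷ y) == x)))

  reach-sym : ∀ k {x z} → reach A k x z ≡ true → reach A k z x ≡ true
  reach-sym zero {x} {z} h = ==-complete (sym (==-sound {x = x} {z} h))
  reach-sym (suc k) {x} {z} h with ∨-elim (reach A k x z) h
  ... | inj₁ xz = reach-suc k (reach-sym k xz)
  ... | inj₂ h' with anyF-elim (λ v → reach A k x v ∧ adj A v z) h'
  ...   | v , xv∧vz =
          reach-trans 1 k (reach-step 0 {z} {z} {v} (==-refl z) (trans (adj-sym z v) (∧-conicalʳ (reach A k x v) _ xv∧vz)))
                          (reach-sym k (∧-conicalˡ _ _ xv∧vz))

  -- Stabilisation from a fixed vertex x: once one more step reaches nothing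
  -- new, no number of further steps does; and this happens by step n,
  -- since otherwise the reachable sets would grow n + 1 times inside Fin n.
  module _ (x : Fin n) where
    Stable : ℕ → Set
    Stable k = ∀ z → reach A (suc k) x z ≡ true → reach A k x z ≡ true

    stable-closed : ∀ {k} → Stable k → ∀ m {z} → reach A (m + k) x z ≡ true → reach A k x z ≡ true
    stable-closed st zero    h = h
    stable-closed {k} st (suc m) {z} h with ∨-elim (reach A (m + k) x z) h
    ... | inj₁ h' = stable-closed st m h'
    ... | inj₂ h' with anyF-elim (λ w → reach A (m + k) x w ∧ adj A w z) h'
    ...   | w , xw∧wz = st z (reach-step k (stable-closed st m (∧-conicalˡ _ _ xw∧wz)) (∧-conicalʳ (reach A (m + k) x w) _ xw∧wz))

    grows-or-stable : ∀ k → k ≤ countF (reach A k x) ⊎ Σ[ j ∈ ℕ ] (j < k × Stable j)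
    grows-or-stable zero = inj₁ z≤n
    grows-or-stable (suc k) with grows-or-stable k
    ... | inj₂ (j , j<k , st) = inj₂ (j , m<n⇒m<1+n j<k , st)
    ... | inj₁ k≤c with countF (reach A (suc k) x) ≤? countF (reach A k x)
    ...   | yes c'≤c = inj₂ (k , n<1+n k , countF-squeeze _ _ (λ z → reach-suc k) c'≤c)
    ...   | no  c'≰c = inj₁ (≤-<-trans k≤c (≰⇒> c'≰c))

    stable-by-n : Σ[ j ∈ ℕ ] (j < suc n × Stable j)
    stable-by-n with grows-or-stable (suc n)
    ... | inj₂ r   = r
    ... | inj₁ n<c = contradiction (≤-trans n<c (countF-≤ (reach A (suc n) x))) (<-irrefl refl)

  reach⇒conn : ∀ m {x z} → reach A m x z ≡ true → conn A x z ≡ true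
  reach⇒conn m {x} h with stable-by-n x
  ... | j , s≤s j≤n , st = reach-mono j≤n (stable-closed x st m (reach-mono (m≤m+n m j) h))

  conn-refl : ∀ x → conn A x x ≡ true
  conn-refl x = reach⇒conn 0 (==-refl x)

  conn-sym : ∀ {x z} → conn A x z ≡ true → conn A z x ≡ true
  conn-sym = reach-sym n

  conn-trans : ∀ {x w z} → conn A x w ≡ true → conn A w z ≡ true → conn A x z ≡ true
  conn-trans xw wz = reach⇒conn (n + n) (reach-trans n n xw wz)

  conn-edge : ∀ {t} a → A t ≡ true → conn A a (a ▷ t) ≡ true
  conn-edge {t} a At with a ≟ (a ▷ t)
  ... | yes a≡at = subst (λ b → conn A a b ≡ true) a≡at (conn-refl a)
  ... | no  a≢at = reach⇒conn 1 (reach-step 0 {a} {a} {a ▷ t} (==-refl a)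
                     (∧-intro (cong not (dec-false (a ≟ (a ▷ t)) a≢at))
                       (anyF-intro (λ y → A y ∧ ((a ▷ y) == (a ▷ t) ∨ ((a ▷ t) ▷ y) == a)) t
                         (∧-intro At (∨-introˡ _ (==-refl (a ▷ t)))))))

  conn-edge⁻ : ∀ {t} a → A t ≡ true → conn A a (inv t a) ≡ true
  conn-edge⁻ {t} a At = conn-sym (subst (λ b → conn A (inv t a) b ≡ true) (inv-r t a) (conn-edge (inv t a) At))

  reach-invariant : (Q : Fin n → Set) → (∀ {v z} → adj A v z ≡ true → Q z → Q v) →
                    ∀ k {j z} → reach A k j z ≡ true → Q z → Q j
  reach-invariant Q step zero    h Qz = subst Q (sym (==-sound h)) Qz
  reach-invariant Q step (suc k) {j} {z} h Qz with ∨-elim (reach A k j z) h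
  ... | inj₁ h' = reach-invariant Q step k h' Qz
  ... | inj₂ h' with anyF-elim (λ v → reach A k j v ∧ adj A v z) h'
  ...   | v , jv∧vz = reach-invariant Q step k (∧-conicalˡ _ _ jv∧vz) (step (∧-conicalʳ (reach A k j v) _ jv∧vz) Qz)

module YSets {n : ℕ} (R : Rack n) (D L : ℕ) (tb : TieBreak n) where
  open Rack R
  open RackDefs R
  open Params D L tb
  open Connectivity R T
  open RackLaws R

  Crossing : Fin n → Fin n → Set
  Crossing j w = Σ[ e ∈ Fin n ] (connT e (e ▷ j) ≡ false × (connT w e ∨ connT w (e ▷ j)) ≡ true)

  InY-intro : ∀ {j w} → Crossing j w → InY j w ≡ true
  InY-intro {j} {w} (e , split , near) =
    anyF-intro (λ x → not (x == (x ▷ j)) ∧ not (connT x (x ▷ j)) ∧ (connT w x ∨ connT w (x ▷ j))) e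
      (∧-intro (cong not no-loop) (∧-intro (cong not split) near))
    where
      no-loop : (e == (e ▷ j)) ≡ false
      no-loop = ¬-not λ loop → not-¬ split (subst (λ b → connT e b ≡ true) (==-sound loop) (conn-refl e))

  InY-elim : ∀ {j w} → InY j w ≡ true → Crossing j w
  InY-elim {j} {w} h with anyF-elim (λ x → not (x == (x ▷ j)) ∧ not (connT x (x ▷ j)) ∧ (connT w x ∨ connT w (x ▷ j))) h
  ... | e , h' = e , not-injective (∧-conicalˡ _ _ rest) , ∧-conicalʳ (not (connT e (e ▷ j))) _ rest
    where rest = ∧-conicalʳ (not (e == (e ▷ j))) _ h'

  InY-conn : ∀ {j w w'} → connT w w' ≡ true → InY j w' ≡ true → InY j w ≡ true
  InY-conn ww' h with InY-elim h
  ... | e , split , near = InY-intro (e , split , ∨-map (conn-trans ww') (conn-trans ww') near)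

  InY-transfer : ∀ {z w} → (∀ e → Σ[ e' ∈ Fin n ] (connT e e' ≡ true × connT (e ▷ z) (e' ▷ w) ≡ true)) →
                 ∀ {x} → InY z x ≡ true → InY w x ≡ true
  InY-transfer {z} {w} match h with InY-elim h
  ... | e , split , near with match e
  ...   | e' , ee' , ez-e'w = InY-intro (e' , split' , ∨-map (λ xe → conn-trans xe ee') (λ xez → conn-trans xez ez-e'w) near)
    where
      split' : connT e' (e' ▷ w) ≡ false
      split' = ¬-not λ joined → not-¬ split (conn-trans ee' (conn-trans joined (conn-sym ez-e'w)))

  -- For t ∈ T(R): Y_{w ▷ t} = Y_w.  The edge e → e ▷ w corresponds to
  -- e ▷ t → (e ▷ w) ▷ t = (e ▷ t) ▷ (w ▷ t), and f_t preserves components.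
  InY-conj : ∀ {t} w x → T t ≡ true → InY (w ▷ t) x ≡ InY w x
  InY-conj {t} w x Tt = bool-ext (InY-transfer pull) (InY-transfer push)
    where
      pull : ∀ e → Σ[ e' ∈ Fin n ] (connT e e' ≡ true × connT (e ▷ (w ▷ t)) (e' ▷ w) ≡ true)
      pull e = inv t e , conn-edge⁻ e Tt ,
               subst (λ b → connT b (inv t e ▷ w) ≡ true) (sym (conj w t e))
                 (conn-sym (conn-edge (inv t e ▷ w) Tt))
      push : ∀ e → Σ[ e' ∈ Fin n ] (connT e e' ≡ true × connT (e ▷ w) (e' ▷ (w ▷ t)) ≡ true)
      push e = e ▷ t , conn-edge e Tt ,
               subst (λ b → connT (e ▷ w) b ≡ true) (sym (self-distrib e w t)) (conn-edge (e ▷ w) Tt)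

  Z-conn : ∀ {j x x'} → connT x x' ≡ true → Z j x ≡ true → Z j x' ≡ true
  Z-conn xx' hx = cong not (¬-not λ y' → not-¬ (not-injective hx) (InY-conn xx' y'))

  Z-conj : ∀ {t} w x → T t ≡ true → Z (w ▷ t) x ≡ Z w x
  Z-conj w x Tt = cong not (InY-conj w x Tt)

module Agreement {n : ℕ} (D L : ℕ) (tb : TieBreak n) (R R' : Rack n)
  (agree-T : ∀ x t → RackDefs.Params.T R D L tb t ≡ true → Rack._▷_ R x t ≡ Rack._▷_ R' x t) where
  open Rack R
  open Rack R' using () renaming (_▷_ to _▷'_)
  open RackDefs R
  open Params D L tb
  open Connectivity R T
  open YSets R D L tb
  open RackLaws R
  open RackLaws R' using () renaming (self-distrib to self-distrib')
  open ≡-Reasoning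

  Agrees : Fin n → Set
  Agrees j = ∀ x → Z j x ≡ true → x ▷ j ≡ x ▷' j

  -- f_{w ▷ t} = f_t⁻¹ f_w f_t, so agreement passes from w to w ▷ t …
  agrees-conj⁺ : ∀ {w t} → T t ≡ true → Agrees w → Agrees (w ▷ t)
  agrees-conj⁺ {w} {t} Tt agrees-w x x∈Z = begin
    x ▷ (w ▷ t)            ≡⟨ cong (_▷ (w ▷ t)) (sym (inv-r t x)) ⟩
    (y ▷ t) ▷ (w ▷ t)      ≡⟨ self-distrib y w t ⟩
    (y ▷ w) ▷ t            ≡⟨ cong (_▷ t) (agrees-w y y∈Z) ⟩
    (y ▷' w) ▷ t           ≡⟨ agree-T (y ▷' w) t Tt ⟩
    (y ▷' w) ▷' t          ≡⟨ sym (self-distrib' y w t) ⟩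
    (y ▷' t) ▷' (w ▷' t)   ≡⟨ cong₂ _▷'_ (sym (agree-T y t Tt)) (sym (agree-T w t Tt)) ⟩
    (y ▷ t) ▷' (w ▷ t)     ≡⟨ cong (_▷' (w ▷ t)) (inv-r t x) ⟩
    x ▷' (w ▷ t)           ∎
    where
      y = inv t x
      y∈Z : Z w y ≡ true
      y∈Z = Z-conn (conn-edge⁻ x Tt) (trans (sym (Z-conj w x Tt)) x∈Z)

  -- … and back from w ▷ t to w, cancelling f_t.
  agrees-conj⁻ : ∀ {w t} → T t ≡ true → Agrees (w ▷ t) → Agrees w
  agrees-conj⁻ {w} {t} Tt agrees-wt x x∈Z = ▷-cancel t (begin
    (x ▷ w) ▷ t            ≡⟨ sym (self-distrib x w t) ⟩
    (x ▷ t) ▷ (w ▷ t)      ≡⟨ agrees-wt (x ▷ t) xt∈Z ⟩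
    (x ▷ t) ▷' (w ▷ t)     ≡⟨ cong₂ _▷'_ (agree-T x t Tt) (agree-T w t Tt) ⟩
    (x ▷' t) ▷' (w ▷' t)   ≡⟨ self-distrib' x w t ⟩
    (x ▷' w) ▷' t          ≡⟨ sym (agree-T (x ▷' w) t Tt) ⟩
    (x ▷' w) ▷ t           ∎)
    where
      xt∈Z : Z (w ▷ t) (x ▷ t) ≡ true
      xt∈Z = trans (Z-conj w (x ▷ t) Tt) (Z-conn (conn-edge x Tt) x∈Z)

  agrees-adj : ∀ {v z} → adj T v z ≡ true → Agrees z → Agrees v
  agrees-adj {v} {z} vz agrees-z
    with anyF-elim (λ y → T y ∧ ((v ▷ y) == z ∨ (z ▷ y) == v)) (∧-conicalʳ (not (v == z)) _ vz)
  ... | t , Tt∧edge with ∨-elim ((v ▷ t) == z) (∧-conicalʳ (T t) _ Tt∧edge)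
  ...   | inj₁ vt≡z = agrees-conj⁻ (∧-conicalˡ _ _ Tt∧edge) (subst Agrees (sym (==-sound vt≡z)) agrees-z)
  ...   | inj₂ zt≡v = subst Agrees (==-sound zt≡v) (agrees-conj⁺ (∧-conicalˡ _ _ Tt∧edge) agrees-z)

  agrees-conn : ∀ {j v} → connT j v ≡ true → Agrees v → Agrees j
  agrees-conn = reach-invariant Agrees agrees-adj n

-- Columns outside S_{≤Δ}, columns in T(R) ⊆ T⁺(R) and the
-- entries recorded on Y are part of 𝓘(R); every other entry x ▷ y has
-- y ∈ S_{≤Δ} ∖ T and x ∈ Z_y, and is fixed because f_y agrees, which
-- follows from agreement at the representative of y's component.
lemma6p4 : ∀ {n : ℕ} (D L : ℕ) → IsFloorLogPow n 3 D → IsFloorLogPow n 2 L →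
           (tb : TieBreak n) → ValidTie tb →
           (R R' : Rack n) (V : Fin n → Set) →
           RackDefs.Params.IsTransversal R D L tb V →
           SameI D L tb R R' →
           (∀ v → V v → ∀ x → RackDefs.Params.Z R D L tb v x ≡ true →
              Rack._▷_ R x v ≡ Rack._▷_ R' x v) →
           RackEq R R'
lemma6p4 D L _ _ tb _ R R' V (represented , _)
         (_ , (_ , agree-fast) , _ , _ , (_ , agree-T⁺) , _ , (_ , agree-Y)) agree-V = entry
  where
    open RackDefs R
    open Params D L tb
    open Agreement D L tb R R' (λ x t t∈T → agree-T⁺ x t (∨-introˡ _ t∈T))

    entry : RackEq R R'
    entry x y with Slow y in slow | T y in y∈T | InY y x in x∈Y
    ... | false | _     | _     = agree-fast x y (cong not slow)
    ... | true  | true  | _     = agree-T⁺ x y (∨-introˡ _ y∈T)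
    ... | true  | false | true  = agree-Y x y (∧-intro (∧-intro slow (cong not y∈T)) x∈Y)
    ... | true  | false | false with represented y
    ...   | v , v∈V , y~v = agrees-conn y~v (agree-V v v∈V) x (cong not x∈Y)
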